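{- Let $m\geqslant 7$, $n\geqslant 7$, $i_1,\dots,i_m\in[n]$ distinct and $j_1,\dots,j_m\in[n]$ distinct. Let $S_k$ ($0\leqslant k\leqslant m$) be as in the context and $S=S_1\cup S_2$. Then for every $P^{[2]}_\sigma\in S_0$ and every $P^{[2]}_{\sigma'}\in S_0$ such that $\sigma'$ is obtained from $\sigma$ by a transposition (swapping the values $\sigma(x),\sigma(y)$ for some $x\neq y$), the matrix $P^{[2]}_\sigma-P^{[2]}_{\sigma'}$ lies in the linear hull of $S$.
   Context: $P_\sigma$ is the $n\times n$ permutation matrix of $\sigma\in S_n$ ($P_\sigma(i,j)=1$ iff $\sigma(i)=j$); $P^{[2]}_\sigma$ is the $n^2\times n^2$ matrix with rows/columns indexed by pairs $(ij)$ and $P^{[2]}_\sigma(ij,kl)=P_\sigma(i,j)P_\sigma(k,l)$; $\mathrm{QAP}_n=\mathrm{conv}\{P^{[2]}_\sigma:\sigma\in S_n\}$. For $0\leqslant k\leqslant m$, $S_k$ is the set of vertices $P^{[2]}_\sigma$ such that $\sigma(i_r)=j_r$ for exactly $k$ indices $r\in[m]$. -}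

module Defs where

open import Data.Nat using (ℕ; zero; suc)
open import Data.Fin using (Fin; zero; suc; _≟_)
open import Data.Fin.Permutation using (Permutation; _⟨$⟩ʳ_)
open import Data.Product using (_×_; _,_; proj₁; proj₂; ∃-syntax)
open import Data.Sum using (_⊎_)
open import Data.List using (List; []; _∷_)
open import Data.List.Relation.Unary.All using (All)
open import Data.Rational using (ℚ; 0ℚ; 1ℚ; _+_; _*_; _-_)
open import Relation.Nullary using (does)
open import Data.Bool using (if_then_else_)
open import Relation.Binary.PropositionalEquality using (_≡_)

P : ∀ {n} → Permutation n n → Fin n → Fin n → ℚ
P σ i j = if does ((σ ⟨$⟩ʳ i) ≟ j) then 1ℚ else 0ℚ

P2 : ∀ {n} → Permutation n n → Fin n × Fin n → Fin n × Fin n → ℚ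
P2 σ (i , j) (k , l) = P σ i j * P σ k l

matchCount : ∀ {m n} → (Fin m → Fin n) → (Fin m → Fin n) → Permutation n n → ℕ
matchCount {zero}  is js σ = zero
matchCount {suc m} is js σ =
  (if does ((σ ⟨$⟩ʳ is zero) ≟ js zero) then suc zero else zero)
  Data.Nat.+ matchCount (λ r → is (suc r)) (λ r → js (suc r)) σ

InS : ∀ {m n} → (Fin m → Fin n) → (Fin m → Fin n) → ℕ → Permutation n n → Set
InS is js k σ = matchCount is js σ ≡ k

InS12 : ∀ {m n} → (Fin m → Fin n) → (Fin m → Fin n) → Permutation n n → Set
InS12 is js σ = InS is js 1 σ ⊎ InS is js 2 σ

combo : ∀ {n} → List (ℚ × Permutation n n) → Fin n × Fin n → Fin n × Fin n → ℚ
combo []             a b = 0ℚ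
combo ((c , τ) ∷ L) a b = c * P2 τ a b + combo L a b

InLinHull : ∀ {n} → (Permutation n n → Set) → (Fin n × Fin n → Fin n × Fin n → ℚ) → Set
InLinHull {n} Q M = ∃[ L ] (All (λ cτ → Q (proj₂ cτ)) L × (∀ a b → M a b ≡ combo L a b))

-- Write σ′ = σ ∘ X with X = (x y). Let g and h be permutations such that g, X and h
-- pairwise have disjoint supports. An entry of P2 π only sees the images of two
-- points, and each point is moved by at most one of g, X, h, so every entry of the
-- alternating sum of P2 over the eight permutations σ ∘ h^c ∘ X^a ∘ g^b vanishes:
-- P2 σ − P2 σ′ is a signed sum of the six vertices with b = 1 or c = 1.
-- Each index r gives an edge i_r → σ⁻¹(j_r); if g and h each create exactly one
-- new match, those six vertices lie in S₁ ∪ S₂. Such moves exist along an edge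
-- avoiding x and y: the transposition of its endpoints, or a 3-cycle through a
-- fresh point when the reverse edge is also present. Among seven edges at least
-- three avoid x and y, and n ≥ 7 leaves a fresh point. If only an idle h (no new
-- match) is available, the vertices with b = 0, c = 1 form a transposition pair
-- in S₀ again, and the argument is repeated once for σ ∘ h.

module Submission where

open import Defs
open import Data.Bool using (Bool; true; false)
open import Data.Empty using (⊥; ⊥-elim)
open import Data.Fin using (Fin; zero; suc; _≟_; punchIn; inject≤) renaming (_<_ to _<ᶠ_)
open import Data.Fin.Patterns using (0F; 1F; 2F; 3F)
open import Data.Fin.Properties
  using (0≢1+n; suc-injective; any?; pigeonhole; <⇒≢; punchIn-injective; punchInᵢ≢i; inject≤-injective)
open import Data.Fin.Permutation
  using (Permutation; _⟨$⟩ʳ_; _⟨$⟩ˡ_; _∘ₚ_; id; _≈_; inverseˡ; inverseʳ)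
  renaming (transpose to transposition)
open import Data.Fin.Permutation.Components using (transpose)
open import Data.List using (List; []; _∷_; _++_; length; lookup)
open import Data.List.Membership.Propositional using (_∈_)
open import Data.List.Relation.Unary.All as All using (All; []; _∷_; all?)
open import Data.List.Relation.Unary.All.Properties using (¬Any⇒All¬; ++⁺)
import Data.List.Relation.Unary.Any as Any
open import Data.List.Relation.Unary.Any.Properties using (lookup-index)
open import Data.Nat using (ℕ; zero; suc; _≤_; _<_; _≥_)
open import Data.Nat.Properties using (n<1+n; n≤1+n; ≤-refl; ≤-trans)
open import Data.Product using (Σ-syntax; ∃₂; _×_; _,_; proj₁; proj₂)
open import Data.Rational using (ℚ; _-_; _+_; _*_; 0ℚ; 1ℚ; -_)
open import Data.Rational.Properties using (+-identityˡ; +-assoc)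
open import Data.Rational.Solver using (module +-*-Solver)
open import Data.Sum using (_⊎_; inj₁; inj₂)
open import Function using (_∘_)
open import Function.Bundles using (Injection)
open import Function.Definitions using (Injective)
open import Function.Properties.Inverse using (↔⇒↣)
open import Relation.Nullary using (¬_; Dec; yes; no)
open import Relation.Nullary.Decidable using (dec-true; ¬?; decidable-stable; _×-dec_)
open import Relation.Binary.PropositionalEquality
  using (_≡_; _≢_; refl; sym; trans; cong; module ≡-Reasoning)

private variable
  m n : ℕ
  P₁ Q₁ R₁ P₂ Q₂ R₂ : Set

transposeˡ : (i j : Fin n) → transpose i j i ≡ j
transposeˡ i j rewrite dec-true (i ≟ i) refl = refl

transposeʳ : (i j : Fin n) → transpose i j j ≡ i
transposeʳ i j with j ≟ i
... | yes j≡i = j≡i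
... | no _ rewrite dec-true (j ≟ j) refl = refl

transpose-fixes : {i j k : Fin n} → k ≢ i → k ≢ j → transpose i j k ≡ k
transpose-fixes {i = i} {j} {k} k≢i k≢j with k ≟ i
... | yes k≡i = ⊥-elim (k≢i k≡i)
... | no _ with k ≟ j
...   | yes k≡j = ⊥-elim (k≢j k≡j)
...   | no _ = refl

⟨$⟩ʳ-injective : (π : Permutation n n) {u v : Fin n} → π ⟨$⟩ʳ u ≡ π ⟨$⟩ʳ v → u ≡ v
⟨$⟩ʳ-injective π = Injection.injective (↔⇒↣ π)

P2-local : (π ρ : Permutation n n) {i j k l : Fin n} →
           π ⟨$⟩ʳ i ≡ ρ ⟨$⟩ʳ i → π ⟨$⟩ʳ k ≡ ρ ⟨$⟩ʳ k →
           P2 π (i , j) (k , l) ≡ P2 ρ (i , j) (k , l)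
P2-local π ρ πi≡ρi πk≡ρk rewrite πi≡ρi | πk≡ρk = refl

P2-cong : (π ρ : Permutation n n) → π ≈ ρ → ∀ A B → P2 π A B ≡ P2 ρ A B
P2-cong π ρ π≈ρ (i , _) (k , _) = P2-local π ρ (π≈ρ i) (π≈ρ k)

module _ {a b c : Fin n} (b≢a : b ≢ a) (c≢a : c ≢ a) (c≢b : c ≢ b) where

  rotate-a : transpose a c (transpose a b a) ≡ b
  rotate-a = trans (cong (transpose a c) (transposeˡ a b)) (transpose-fixes b≢a (c≢b ∘ sym))

  rotate-b : transpose a c (transpose a b b) ≡ c
  rotate-b = trans (cong (transpose a c) (transposeʳ a b)) (transposeˡ a c)

  rotate-c : transpose a c (transpose a b c) ≡ a
  rotate-c = trans (cong (transpose a c) (transpose-fixes c≢a c≢b)) (transposeʳ a c)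

rotate-fixes : {a b c z : Fin n} → z ≢ a → z ≢ b → z ≢ c → transpose a c (transpose a b z) ≡ z
rotate-fixes z≢a z≢b z≢c = trans (cong (transpose _ _) (transpose-fixes z≢a z≢b)) (transpose-fixes z≢a z≢c)

fresh : (L : List (Fin n)) → length L < n → Σ[ s ∈ Fin n ] All (s ≢_) L
fresh L |L|<n with any? (λ s → ¬? (Any.any? (s ≟_) L))
... | yes (s , s∉L) = s , ¬Any⇒All¬ L s∉L
... | no none = ⊥-elim (collision (pigeonhole |L|<n (Any.index ∘ member)))
  where
    member : ∀ s → s ∈ L
    member s = decidable-stable (Any.any? (s ≟_) L) (λ s∉L → none (s , s∉L))
    collision : ¬ ∃₂ (λ i j → i <ᶠ j × Any.index (member i) ≡ Any.index (member j))
    collision (i , j , i<j , same) =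
      <⇒≢ i<j (trans (lookup-index (member i)) (trans (cong (lookup L) same) (sym (lookup-index (member j)))))

∘punchIn-injective : {φ : Fin (suc n) → Fin m} → Injective _≡_ _≡_ φ → ∀ i → Injective _≡_ _≡_ (φ ∘ punchIn i)
∘punchIn-injective φ-inj i = punchIn-injective i _ _ ∘ φ-inj

∘punchIn-misses : {φ : Fin (suc n) → Fin m} → Injective _≡_ _≡_ φ → ∀ i j → φ (punchIn i j) ≢ φ i
∘punchIn-misses φ-inj i j = punchInᵢ≢i i j ∘ φ-inj

Match : (is js : Fin m → Fin n) → Permutation n n → Fin m → Set
Match is js π r = π ⟨$⟩ʳ is r ≡ js r

NoMatch : (is js : Fin m → Fin n) → Permutation n n → Set
NoMatch is js π = ∀ r → ¬ Match is js π r

UniqueMatch : (is js : Fin m → Fin n) → Permutation n n → Fin m → Set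
UniqueMatch is js π r₀ = Match is js π r₀ × (∀ r → Match is js π r → r ≡ r₀)

module _ (is js : Fin (suc m) → Fin n) (π : Permutation n n) where

  matchCount-headMatch : Match is js π zero → matchCount is js π ≡ suc (matchCount (is ∘ suc) (js ∘ suc) π)
  matchCount-headMatch hit with π ⟨$⟩ʳ is zero ≟ js zero
  ... | yes _ = refl
  ... | no miss = ⊥-elim (miss hit)

  matchCount-headMiss : ¬ Match is js π zero → matchCount is js π ≡ matchCount (is ∘ suc) (js ∘ suc) π
  matchCount-headMiss miss with π ⟨$⟩ʳ is zero ≟ js zero
  ... | yes hit = ⊥-elim (miss hit)
  ... | no _ = refl

matchCount≡0⇒noMatch : (is js : Fin m → Fin n) (π : Permutation n n) →
                       matchCount is js π ≡ 0 → NoMatch is js π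
matchCount≡0⇒noMatch is js π count≡0 zero hit
  with () ← trans (sym (matchCount-headMatch is js π hit)) count≡0
matchCount≡0⇒noMatch is js π count≡0 (suc r) hit with π ⟨$⟩ʳ is zero ≟ js zero
... | no _ = matchCount≡0⇒noMatch (is ∘ suc) (js ∘ suc) π count≡0 r hit
matchCount≡0⇒noMatch is js π () (suc r) hit | yes _

noMatch⇒matchCount≡0 : (is js : Fin m → Fin n) (π : Permutation n n) →
                       NoMatch is js π → matchCount is js π ≡ 0
noMatch⇒matchCount≡0 {zero} is js π none = refl
noMatch⇒matchCount≡0 {suc m} is js π none =
  trans (matchCount-headMiss is js π (none zero)) (noMatch⇒matchCount≡0 (is ∘ suc) (js ∘ suc) π (none ∘ suc))

uniqueMatch⇒matchCount≡1 : (is js : Fin m → Fin n) (π : Permutation n n) (r₀ : Fin m) →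
                           UniqueMatch is js π r₀ → matchCount is js π ≡ 1
uniqueMatch⇒matchCount≡1 is js π zero (hit , only) =
  trans (matchCount-headMatch is js π hit)
        (cong suc (noMatch⇒matchCount≡0 (is ∘ suc) (js ∘ suc) π λ r hitᵣ → 0≢1+n (sym (only (suc r) hitᵣ))))
uniqueMatch⇒matchCount≡1 is js π (suc r₀) (hit , only) =
  trans (matchCount-headMiss is js π (λ hit₀ → 0≢1+n (only zero hit₀)))
        (uniqueMatch⇒matchCount≡1 (is ∘ suc) (js ∘ suc) π r₀ (hit , λ r hitᵣ → suc-injective (only (suc r) hitᵣ)))

twoMatches⇒matchCount≡2 : (is js : Fin m → Fin n) (π : Permutation n n) (r₁ r₂ : Fin m) → r₁ ≢ r₂ →
                          Match is js π r₁ → Match is js π r₂ →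
                          (∀ r → Match is js π r → r ≡ r₁ ⊎ r ≡ r₂) → matchCount is js π ≡ 2
twoMatches⇒matchCount≡2 is js π zero zero r₁≢r₂ _ _ _ = ⊥-elim (r₁≢r₂ refl)
twoMatches⇒matchCount≡2 is js π zero (suc r₂) _ hit₁ hit₂ only =
  trans (matchCount-headMatch is js π hit₁)
        (cong suc (uniqueMatch⇒matchCount≡1 (is ∘ suc) (js ∘ suc) π r₂ (hit₂ , λ r hitᵣ → second (only (suc r) hitᵣ))))
  where second : ∀ {r} → suc r ≡ zero ⊎ suc r ≡ suc r₂ → r ≡ r₂
        second (inj₁ ())
        second (inj₂ refl) = refl
twoMatches⇒matchCount≡2 is js π (suc r₁) zero _ hit₁ hit₂ only =
  trans (matchCount-headMatch is js π hit₂)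
        (cong suc (uniqueMatch⇒matchCount≡1 (is ∘ suc) (js ∘ suc) π r₁ (hit₁ , λ r hitᵣ → first (only (suc r) hitᵣ))))
  where first : ∀ {r} → suc r ≡ suc r₁ ⊎ suc r ≡ zero → r ≡ r₁
        first (inj₁ refl) = refl
        first (inj₂ ())
twoMatches⇒matchCount≡2 is js π (suc r₁) (suc r₂) r₁≢r₂ hit₁ hit₂ only =
  trans (matchCount-headMiss is js π (headNotOnly ∘ only zero))
        (twoMatches⇒matchCount≡2 (is ∘ suc) (js ∘ suc) π r₁ r₂ (r₁≢r₂ ∘ cong suc) hit₁ hit₂ (λ r → tailOnly ∘ only (suc r)))
  where headNotOnly : ¬ (zero ≡ suc r₁ ⊎ zero ≡ suc r₂)
        headNotOnly (inj₁ ())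
        headNotOnly (inj₂ ())
        tailOnly : ∀ {r} → suc r ≡ suc r₁ ⊎ suc r ≡ suc r₂ → r ≡ r₁ ⊎ r ≡ r₂
        tailOnly (inj₁ refl) = inj₁ refl
        tailOnly (inj₂ refl) = inj₂ refl

P2-diff : Permutation n n → Permutation n n → Fin n × Fin n → Fin n × Fin n → ℚ
P2-diff π ρ A B = P2 π A B - P2 ρ A B

Spanned : (is js : Fin m → Fin n) → (Fin n × Fin n → Fin n × Fin n → ℚ) → Set
Spanned is js = InLinHull (InS12 is js)

combo-++ : (L L′ : List (ℚ × Permutation n n)) → ∀ A B → combo (L ++ L′) A B ≡ combo L A B + combo L′ A B
combo-++ [] L′ A B = sym (+-identityˡ _)
combo-++ ((c , τ) ∷ L) L′ A B =
  trans (cong (c * P2 τ A B +_) (combo-++ L L′ A B)) (sym (+-assoc (c * P2 τ A B) (combo L A B) (combo L′ A B)))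

module _ (F : Bool → Bool → Bool → ℚ) where
  open +-*-Solver

  CubeRelation : Set
  CubeRelation = F false false false - F true false false
               ≡ (F false true false - F true true false) + (F false false true - F true false true)
                 - (F false true true - F true true true)

  constant-in-1st⇒cubeRelation : (∀ b c → F true b c ≡ F false b c) → CubeRelation
  constant-in-1st⇒cubeRelation eq rewrite eq false false | eq true false | eq false true | eq true true =
    solve 4 (λ u v w t → u :- u := (v :- v) :+ (w :- w) :- (t :- t)) refl
      (F false false false) (F false true false) (F false false true) (F false true true)

  constant-in-2nd⇒cubeRelation : (∀ a c → F a true c ≡ F a false c) → CubeRelation
  constant-in-2nd⇒cubeRelation eq rewrite eq false false | eq true false | eq false true | eq true true =
    solve 4 (λ u v w t → u :- v := (u :- v) :+ (w :- t) :- (w :- t)) refl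
      (F false false false) (F true false false) (F false false true) (F true false true)

  constant-in-3rd⇒cubeRelation : (∀ a b → F a b true ≡ F a b false) → CubeRelation
  constant-in-3rd⇒cubeRelation eq rewrite eq false false | eq true false | eq false true | eq true true =
    solve 4 (λ u v w t → u :- v := (w :- t) :+ (u :- v) :- (w :- t)) refl
      (F false false false) (F true false false) (F false true false) (F true true false)

  cubeRelation⇒sixTerms :
    CubeRelation →
    F false false false - F true false false
    ≡ 1ℚ * F false true false + ((- 1ℚ) * F true true false + (1ℚ * F false false true
      + ((- 1ℚ) * F true false true + ((- 1ℚ) * F false true true + (1ℚ * F true true true + 0ℚ)))))
  cubeRelation⇒sixTerms rel = trans rel
    (solve 6 (λ u v w t p q → (u :- v) :+ (w :- t) :- (p :- q)
                            := con 1ℚ :* u :+ (con (- 1ℚ) :* v :+ (con 1ℚ :* w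
                               :+ (con (- 1ℚ) :* t :+ (con (- 1ℚ) :* p :+ (con 1ℚ :* q :+ con 0ℚ))))))
       refl (F false true false) (F true true false) (F false false true)
            (F true false true) (F false true true) (F true true true))

  cubeRelation⇒fourTerms :
    CubeRelation →
    F false false false - F true false false
    ≡ (1ℚ * F false true false + ((- 1ℚ) * F true true false
       + ((- 1ℚ) * F false true true + (1ℚ * F true true true + 0ℚ))))
      + (F false false true - F true false true)
  cubeRelation⇒fourTerms rel = trans rel
    (solve 6 (λ u v w t p q → (u :- v) :+ (w :- t) :- (p :- q)
                            := (con 1ℚ :* u :+ (con (- 1ℚ) :* v :+ (con (- 1ℚ) :* p :+ (con 1ℚ :* q :+ con 0ℚ))))
                               :+ (w :- t))
       refl (F false true false) (F true true false) (F false false true)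
            (F true false true) (F false true true) (F true true true))

TwoOf : Set → Set → Set → Set
TwoOf P Q R = (Q × R) ⊎ (P × R) ⊎ (P × Q)

twoOf-common : TwoOf P₁ Q₁ R₁ → TwoOf P₂ Q₂ R₂ → (P₁ × P₂) ⊎ (Q₁ × Q₂) ⊎ (R₁ × R₂)
twoOf-common (inj₁ (_ , r₁))         (inj₁ (_ , r₂))         = inj₂ (inj₂ (r₁ , r₂))
twoOf-common (inj₁ (_ , r₁))         (inj₂ (inj₁ (_ , r₂)))  = inj₂ (inj₂ (r₁ , r₂))
twoOf-common (inj₁ (q₁ , _))         (inj₂ (inj₂ (_ , q₂)))  = inj₂ (inj₁ (q₁ , q₂))
twoOf-common (inj₂ (inj₁ (_ , r₁)))  (inj₁ (_ , r₂))         = inj₂ (inj₂ (r₁ , r₂))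
twoOf-common (inj₂ (inj₁ (p₁ , _)))  (inj₂ (inj₁ (p₂ , _)))  = inj₁ (p₁ , p₂)
twoOf-common (inj₂ (inj₁ (p₁ , _)))  (inj₂ (inj₂ (p₂ , _)))  = inj₁ (p₁ , p₂)
twoOf-common (inj₂ (inj₂ (_ , q₁)))  (inj₁ (q₂ , _))         = inj₂ (inj₁ (q₁ , q₂))
twoOf-common (inj₂ (inj₂ (p₁ , _)))  (inj₂ (inj₁ (p₂ , _)))  = inj₁ (p₁ , p₂)
twoOf-common (inj₂ (inj₂ (p₁ , _)))  (inj₂ (inj₂ (p₂ , _)))  = inj₁ (p₁ , p₂)

Disjoint : Permutation n n → Permutation n n → Set
Disjoint p q = ∀ z → p ⟨$⟩ʳ z ≡ z ⊎ q ⟨$⟩ʳ z ≡ z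

disjoint-sym : (p q : Permutation n n) → Disjoint p q → Disjoint q p
disjoint-sym p q p#q z with p#q z
... | inj₁ pz≡z = inj₂ pz≡z
... | inj₂ qz≡z = inj₁ qz≡z

disjoint-fixesʳ : (p q : Permutation n n) → Disjoint p q → ∀ {z} → p ⟨$⟩ʳ z ≢ z → q ⟨$⟩ʳ z ≡ z
disjoint-fixesʳ p q p#q {z} pz≢z with p#q z
... | inj₁ pz≡z = ⊥-elim (pz≢z pz≡z)
... | inj₂ qz≡z = qz≡z

disjoint-fixesˡ : (p q : Permutation n n) → Disjoint p q → ∀ {z} → q ⟨$⟩ʳ z ≢ z → p ⟨$⟩ʳ z ≡ z
disjoint-fixesˡ p q p#q = disjoint-fixesʳ q p (disjoint-sym p q p#q)

moved-image : (π : Permutation n n) {z : Fin n} → π ⟨$⟩ʳ z ≢ z → π ⟨$⟩ʳ (π ⟨$⟩ʳ z) ≢ π ⟨$⟩ʳ z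
moved-image π πz≢z = πz≢z ∘ ⟨$⟩ʳ-injective π

_^_ : Permutation n n → Bool → Permutation n n
π ^ true  = π
π ^ false = id

^-fixes : (π : Permutation n n) {z : Fin n} → π ⟨$⟩ʳ z ≡ z → ∀ b → (π ^ b) ⟨$⟩ʳ z ≡ z
^-fixes π πz≡z true  = πz≡z
^-fixes π πz≡z false = refl

^-moved : (π : Permutation n n) {z : Fin n} → π ⟨$⟩ʳ z ≢ z → ∀ b → π ⟨$⟩ʳ ((π ^ b) ⟨$⟩ʳ z) ≢ (π ^ b) ⟨$⟩ʳ z
^-moved π πz≢z true  = moved-image π πz≢z
^-moved π πz≢z false = πz≢z

moved-by-match : (is js : Fin m → Fin n) (τ π : Permutation n n) → NoMatch is js τ →
                 ∀ {r} → Match is js (π ∘ₚ τ) r → π ⟨$⟩ʳ is r ≢ is r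
moved-by-match is js τ π none {r} hit πa≡a = none r (trans (cong (τ ⟨$⟩ʳ_) (sym πa≡a)) hit)

-- π ∘ₚ ρ applies π first, so vertex a b c sends z to σ (h^c (X^a (g^b z))).
module Cube (σ X g h : Permutation n n) (g#X : Disjoint g X) (g#h : Disjoint g h) (X#h : Disjoint X h) where

  composite : Bool → Bool → Bool → Permutation n n
  composite a b c = (g ^ b) ∘ₚ (X ^ a) ∘ₚ (h ^ c)

  vertex : Bool → Bool → Bool → Permutation n n
  vertex a b c = composite a b c ∘ₚ σ

  composite-on-g : ∀ {z} → g ⟨$⟩ʳ z ≢ z → ∀ a b c → composite a b c ⟨$⟩ʳ z ≡ (g ^ b) ⟨$⟩ʳ z
  composite-on-g gz≢z a b c =
    trans (cong ((h ^ c) ⟨$⟩ʳ_) (^-fixes X (disjoint-fixesʳ g X g#X (^-moved g gz≢z b)) a))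
          (^-fixes h (disjoint-fixesʳ g h g#h (^-moved g gz≢z b)) c)

  composite-on-X : ∀ {z} → g ⟨$⟩ʳ z ≡ z → X ⟨$⟩ʳ z ≢ z → ∀ a b c → composite a b c ⟨$⟩ʳ z ≡ (X ^ a) ⟨$⟩ʳ z
  composite-on-X gz≡z Xz≢z a b c =
    trans (cong (λ w → (h ^ c) ⟨$⟩ʳ ((X ^ a) ⟨$⟩ʳ w)) (^-fixes g gz≡z b))
          (^-fixes h (disjoint-fixesʳ X h X#h (^-moved X Xz≢z a)) c)

  composite-off-g-X : ∀ {z} → g ⟨$⟩ʳ z ≡ z → X ⟨$⟩ʳ z ≡ z → ∀ a b c → composite a b c ⟨$⟩ʳ z ≡ (h ^ c) ⟨$⟩ʳ z
  composite-off-g-X gz≡z Xz≡z a b c =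
    cong ((h ^ c) ⟨$⟩ʳ_) (trans (cong ((X ^ a) ⟨$⟩ʳ_) (^-fixes g gz≡z b)) (^-fixes X Xz≡z a))

  IgnoresX IgnoresG IgnoresH : Fin n → Set
  IgnoresX z = ∀ b c → composite true b c ⟨$⟩ʳ z ≡ composite false b c ⟨$⟩ʳ z
  IgnoresG z = ∀ a c → composite a true c ⟨$⟩ʳ z ≡ composite a false c ⟨$⟩ʳ z
  IgnoresH z = ∀ a b → composite a b true ⟨$⟩ʳ z ≡ composite a b false ⟨$⟩ʳ z

  ignoresTwo : ∀ z → TwoOf (IgnoresX z) (IgnoresG z) (IgnoresH z)
  ignoresTwo z with g ⟨$⟩ʳ z ≟ z
  ... | no gz≢z = inj₂ (inj₁ ( (λ b c → trans (on-g true b c) (sym (on-g false b c)))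
                             , (λ a b → trans (on-g a b true) (sym (on-g a b false)))))
    where on-g = composite-on-g gz≢z
  ... | yes gz≡z with X ⟨$⟩ʳ z ≟ z
  ...   | no Xz≢z = inj₁ ( (λ a c → trans (on-X a true c) (sym (on-X a false c)))
                         , (λ a b → trans (on-X a b true) (sym (on-X a b false))))
    where on-X = composite-on-X gz≡z Xz≢z
  ...   | yes Xz≡z = inj₂ (inj₂ ( (λ b c → trans (on-h true b c) (sym (on-h false b c)))
                               , (λ a c → trans (on-h a true c) (sym (on-h a false c)))))
    where on-h = composite-off-g-X gz≡z Xz≡z

  entry : Fin n × Fin n → Fin n × Fin n → Bool → Bool → Bool → ℚ
  entry A B a b c = P2 (vertex a b c) A B

  vertex-cubeRelation : ∀ A B → CubeRelation (entry A B)
  vertex-cubeRelation (i , j) (k , l) with twoOf-common (ignoresTwo i) (ignoresTwo k)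
  ... | inj₁ (Xi , Xk) = constant-in-1st⇒cubeRelation (entry (i , j) (k , l)) λ b c →
    P2-local (vertex true b c) (vertex false b c) (cong (σ ⟨$⟩ʳ_) (Xi b c)) (cong (σ ⟨$⟩ʳ_) (Xk b c))
  ... | inj₂ (inj₁ (Gi , Gk)) = constant-in-2nd⇒cubeRelation (entry (i , j) (k , l)) λ a c →
    P2-local (vertex a true c) (vertex a false c) (cong (σ ⟨$⟩ʳ_) (Gi a c)) (cong (σ ⟨$⟩ʳ_) (Gk a c))
  ... | inj₂ (inj₂ (Hi , Hk)) = constant-in-3rd⇒cubeRelation (entry (i , j) (k , l)) λ a b →
    P2-local (vertex a b true) (vertex a b false) (cong (σ ⟨$⟩ʳ_) (Hi a b)) (cong (σ ⟨$⟩ʳ_) (Hk a b))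

  module Matches {m : ℕ} (is js : Fin m → Fin n) (σ-none : NoMatch is js σ) (Xσ-none : NoMatch is js (X ∘ₚ σ)) where

    vertex-match : ∀ a b c {r} → Match is js (vertex a b c) r →
                   (b ≡ true × Match is js (g ∘ₚ σ) r) ⊎ (c ≡ true × Match is js (h ∘ₚ σ) r)
    vertex-match a b c {r} hit with g ⟨$⟩ʳ is r ≟ is r
    ... | no ga≢a = by-g b (trans (cong (σ ⟨$⟩ʳ_) (sym (composite-on-g ga≢a a b c))) hit)
      where by-g : ∀ b′ → Match is js ((g ^ b′) ∘ₚ σ) r →
                   (b′ ≡ true × Match is js (g ∘ₚ σ) r) ⊎ (c ≡ true × Match is js (h ∘ₚ σ) r)
            by-g true  hitᵍ = inj₁ (refl , hitᵍ)
            by-g false hitᵍ = ⊥-elim (σ-none r hitᵍ)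
    ... | yes ga≡a with X ⟨$⟩ʳ is r ≟ is r
    ...   | no Xa≢a = ⊥-elim (by-X a (trans (cong (σ ⟨$⟩ʳ_) (sym (composite-on-X ga≡a Xa≢a a b c))) hit))
      where by-X : ∀ a′ → ¬ Match is js ((X ^ a′) ∘ₚ σ) r
            by-X true  = Xσ-none r
            by-X false = σ-none r
    ...   | yes Xa≡a = by-h c (trans (cong (σ ⟨$⟩ʳ_) (sym (composite-off-g-X ga≡a Xa≡a a b c))) hit)
      where by-h : ∀ c′ → Match is js ((h ^ c′) ∘ₚ σ) r →
                   (b ≡ true × Match is js (g ∘ₚ σ) r) ⊎ (c′ ≡ true × Match is js (h ∘ₚ σ) r)
            by-h true  hitʰ = inj₂ (refl , hitʰ)
            by-h false hitʰ = ⊥-elim (σ-none r hitʰ)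

    g-match⇒vertex-match : ∀ a c {r} → Match is js (g ∘ₚ σ) r → Match is js (vertex a true c) r
    g-match⇒vertex-match a c hit =
      trans (cong (σ ⟨$⟩ʳ_) (composite-on-g (moved-by-match is js σ g σ-none hit) a true c)) hit

    h-match⇒vertex-match : ∀ a b {r} → Match is js (h ∘ₚ σ) r → Match is js (vertex a b true) r
    h-match⇒vertex-match a b {r} hit = trans (cong (σ ⟨$⟩ʳ_) (composite-off-g-X ga≡a Xa≡a a b true)) hit
      where
        ha≢a : h ⟨$⟩ʳ is r ≢ is r
        ha≢a = moved-by-match is js σ h σ-none hit
        ga≡a : g ⟨$⟩ʳ is r ≡ is r
        ga≡a = disjoint-fixesˡ g h g#h ha≢a
        Xa≡a : X ⟨$⟩ʳ is r ≡ is r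
        Xa≡a = disjoint-fixesˡ X h X#h ha≢a

    g-h-matches-disjoint : ∀ {r} → Match is js (g ∘ₚ σ) r → Match is js (h ∘ₚ σ) r → ⊥
    g-h-matches-disjoint {r} hitᵍ hitʰ with g#h (is r)
    ... | inj₁ ga≡a = moved-by-match is js σ g σ-none hitᵍ ga≡a
    ... | inj₂ ha≡a = moved-by-match is js σ h σ-none hitʰ ha≡a

    uniqueMatch-g : ∀ a {r₁} → UniqueMatch is js (g ∘ₚ σ) r₁ → UniqueMatch is js (vertex a true false) r₁
    uniqueMatch-g a (hit , only) = g-match⇒vertex-match a false hit , only′
      where only′ : ∀ r → Match is js (vertex a true false) r → _
            only′ r hitᵣ with vertex-match a true false hitᵣ
            ... | inj₁ (_ , hitᵍ) = only r hitᵍ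
            ... | inj₂ (() , _)

    uniqueMatch-h : ∀ a {r₂} → UniqueMatch is js (h ∘ₚ σ) r₂ → UniqueMatch is js (vertex a false true) r₂
    uniqueMatch-h a (hit , only) = h-match⇒vertex-match a false hit , only′
      where only′ : ∀ r → Match is js (vertex a false true) r → _
            only′ r hitᵣ with vertex-match a false true hitᵣ
            ... | inj₁ (() , _)
            ... | inj₂ (_ , hitʰ) = only r hitʰ

    uniqueMatch-g-idle-h : ∀ a {r₁} → UniqueMatch is js (g ∘ₚ σ) r₁ → NoMatch is js (h ∘ₚ σ) →
                           UniqueMatch is js (vertex a true true) r₁
    uniqueMatch-g-idle-h a (hit , only) idle = g-match⇒vertex-match a true hit , only′
      where only′ : ∀ r → Match is js (vertex a true true) r → _
            only′ r hitᵣ with vertex-match a true true hitᵣ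
            ... | inj₁ (_ , hitᵍ) = only r hitᵍ
            ... | inj₂ (_ , hitʰ) = ⊥-elim (idle r hitʰ)

    matchCount-g-h≡2 : ∀ a {r₁ r₂} → UniqueMatch is js (g ∘ₚ σ) r₁ → UniqueMatch is js (h ∘ₚ σ) r₂ →
                       matchCount is js (vertex a true true) ≡ 2
    matchCount-g-h≡2 a {r₁} {r₂} (hitᵍ , onlyᵍ) (hitʰ , onlyʰ) =
      twoMatches⇒matchCount≡2 is js (vertex a true true) r₁ r₂ r₁≢r₂
        (g-match⇒vertex-match a true hitᵍ) (h-match⇒vertex-match a true hitʰ) only′
      where
        r₁≢r₂ : r₁ ≢ r₂
        r₁≢r₂ refl = g-h-matches-disjoint hitᵍ hitʰ
        only′ : ∀ r → Match is js (vertex a true true) r → r ≡ r₁ ⊎ r ≡ r₂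
        only′ r hitᵣ with vertex-match a true true hitᵣ
        ... | inj₁ (_ , hitᵍ′) = inj₁ (onlyᵍ r hitᵍ′)
        ... | inj₂ (_ , hitʰ′) = inj₂ (onlyʰ r hitʰ′)

    idle-h⇒noMatch-X∘h : NoMatch is js (h ∘ₚ σ) → NoMatch is js (X ∘ₚ h ∘ₚ σ)
    idle-h⇒noMatch-X∘h idle r hit with vertex-match true false true hit
    ... | inj₁ (() , _)
    ... | inj₂ (_ , hitʰ) = idle r hitʰ

    spanned-if-g-h-single : (σ′ : Permutation n n) → σ′ ≈ X ∘ₚ σ → ∀ {r₁ r₂} →
                            UniqueMatch is js (g ∘ₚ σ) r₁ → UniqueMatch is js (h ∘ₚ σ) r₂ →
                            Spanned is js (P2-diff σ σ′)
    spanned-if-g-h-single σ′ σ′≈Xσ {r₁} {r₂} singleᵍ singleʰ = L , inS , expand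
      where
        L : List (ℚ × Permutation n n)
        L = (1ℚ , vertex false true false) ∷ (- 1ℚ , vertex true true false)
          ∷ (1ℚ , vertex false false true) ∷ (- 1ℚ , vertex true false true)
          ∷ (- 1ℚ , vertex false true true) ∷ (1ℚ , vertex true true true) ∷ []
        one-g : ∀ a → InS12 is js (vertex a true false)
        one-g a = inj₁ (uniqueMatch⇒matchCount≡1 is js _ r₁ (uniqueMatch-g a singleᵍ))
        one-h : ∀ a → InS12 is js (vertex a false true)
        one-h a = inj₁ (uniqueMatch⇒matchCount≡1 is js _ r₂ (uniqueMatch-h a singleʰ))
        two : ∀ a → InS12 is js (vertex a true true)
        two a = inj₂ (matchCount-g-h≡2 a singleᵍ singleʰ)
        inS : All (λ cτ → InS12 is js (proj₂ cτ)) L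
        inS = one-g false ∷ one-g true ∷ one-h false ∷ one-h true ∷ two false ∷ two true ∷ []
        expand : ∀ A B → P2-diff σ σ′ A B ≡ combo L A B
        expand A B = trans (cong (λ t → P2 σ A B - t) (P2-cong σ′ (X ∘ₚ σ) σ′≈Xσ A B))
                           (cubeRelation⇒sixTerms (entry A B) (vertex-cubeRelation A B))

    -- σ ∘ h and σ ∘ h ∘ X again lie in S₀ and differ by X: they need a second round of moves.
    spanned-if-g-single-h-idle : (σ′ : Permutation n n) → σ′ ≈ X ∘ₚ σ → ∀ {r₁} →
                                 UniqueMatch is js (g ∘ₚ σ) r₁ → NoMatch is js (h ∘ₚ σ) →
                                 Spanned is js (P2-diff (h ∘ₚ σ) (X ∘ₚ h ∘ₚ σ)) →
                                 Spanned is js (P2-diff σ σ′)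
    spanned-if-g-single-h-idle σ′ σ′≈Xσ {r₁} singleᵍ idle (L′ , inS′ , expand′) =
      L ++ L′ , ++⁺ inS inS′ , expand
      where
        L : List (ℚ × Permutation n n)
        L = (1ℚ , vertex false true false) ∷ (- 1ℚ , vertex true true false)
          ∷ (- 1ℚ , vertex false true true) ∷ (1ℚ , vertex true true true) ∷ []
        one-g : ∀ a → InS12 is js (vertex a true false)
        one-g a = inj₁ (uniqueMatch⇒matchCount≡1 is js _ r₁ (uniqueMatch-g a singleᵍ))
        one-gh : ∀ a → InS12 is js (vertex a true true)
        one-gh a = inj₁ (uniqueMatch⇒matchCount≡1 is js _ r₁ (uniqueMatch-g-idle-h a singleᵍ idle))
        inS : All (λ cτ → InS12 is js (proj₂ cτ)) L
        inS = one-g false ∷ one-g true ∷ one-gh false ∷ one-gh true ∷ []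
        expand : ∀ A B → P2-diff σ σ′ A B ≡ combo (L ++ L′) A B
        expand A B = begin
          P2-diff σ σ′ A B                       ≡⟨ cong (λ t → P2 σ A B - t) (P2-cong σ′ (X ∘ₚ σ) σ′≈Xσ A B) ⟩
          entry A B false false false - entry A B true false false
            ≡⟨ cubeRelation⇒fourTerms (entry A B) (vertex-cubeRelation A B) ⟩
          combo L A B + P2-diff (h ∘ₚ σ) (X ∘ₚ h ∘ₚ σ) A B ≡⟨ cong (combo L A B +_) (expand′ A B) ⟩
          combo L A B + combo L′ A B             ≡⟨ sym (combo-++ L L′ A B) ⟩
          combo (L ++ L′) A B                    ∎
          where open ≡-Reasoning

module Moves {m n : ℕ} (is js : Fin m → Fin n) (is-inj : Injective _≡_ _≡_ is) (js-inj : Injective _≡_ _≡_ js)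
             (σ : Permutation n n) (x y : Fin n)
             (σ-none : NoMatch is js σ) (Xσ-none : NoMatch is js (transposition x y ∘ₚ σ)) where

  X : Permutation n n
  X = transposition x y

  -- Index r is the edge is r → tgt r: π ∘ₚ σ matches r iff π (is r) ≡ tgt r.
  tgt : Fin m → Fin n
  tgt r = σ ⟨$⟩ˡ js r

  match⇒tgt : ∀ {w r} → σ ⟨$⟩ʳ w ≡ js r → w ≡ tgt r
  match⇒tgt hit = trans (sym (inverseˡ σ)) (cong (σ ⟨$⟩ˡ_) hit)

  tgt⇒match : ∀ {w r} → w ≡ tgt r → σ ⟨$⟩ʳ w ≡ js r
  tgt⇒match refl = inverseʳ σ

  tgt-injective : Injective _≡_ _≡_ tgt
  tgt-injective tgt≡ = js-inj (trans (sym (inverseʳ σ)) (trans (cong (σ ⟨$⟩ʳ_) tgt≡) (inverseʳ σ)))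

  is≢tgt : ∀ r → is r ≢ tgt r
  is≢tgt r a≡b = σ-none r (tgt⇒match a≡b)

  Clear : (Fin n → Fin n) → Fin n → Set
  Clear ψ v = ∀ r → is r ≡ v → tgt r ≢ ψ v

  match-source-∈ : (ψ : Fin n → Fin n) (W : List (Fin n)) → (∀ z → All (z ≢_) W → ψ z ≡ z) →
                   ∀ {r} → ψ (is r) ≡ tgt r → is r ∈ W
  match-source-∈ ψ W fixed {r} hit with Any.any? (is r ≟_) W
  ... | yes a∈W = a∈W
  ... | no a∉W = ⊥-elim (is≢tgt r (trans (sym (fixed (is r) (¬Any⇒All¬ W a∉W))) hit))

  uniqueMatch-by-table : (κ g : Permutation n n) (W : List (Fin n)) →
                         (∀ z → All (z ≢_) W → κ ⟨$⟩ʳ (g ⟨$⟩ʳ z) ≡ z) → ∀ r₀ →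
                         κ ⟨$⟩ʳ (g ⟨$⟩ʳ is r₀) ≡ tgt r₀ →
                         All (λ v → v ≡ is r₀ ⊎ Clear (λ z → κ ⟨$⟩ʳ (g ⟨$⟩ʳ z)) v) W →
                         UniqueMatch is js (g ∘ₚ κ ∘ₚ σ) r₀
  uniqueMatch-by-table κ g W fixed r₀ hit₀ table = tgt⇒match hit₀ , only
    where
      only : ∀ r → Match is js (g ∘ₚ κ ∘ₚ σ) r → r ≡ r₀
      only r hit with All.lookup table (match-source-∈ _ W fixed (match⇒tgt hit))
      ... | inj₁ a≡a₀ = is-inj a≡a₀
      ... | inj₂ clear = ⊥-elim (clear r refl (sym (match⇒tgt hit)))

  noMatch-by-table : (g : Permutation n n) (W : List (Fin n)) → (∀ z → All (z ≢_) W → g ⟨$⟩ʳ z ≡ z) →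
                     All (Clear (g ⟨$⟩ʳ_)) W → NoMatch is js (g ∘ₚ σ)
  noMatch-by-table g W fixed table r hit =
    All.lookup table (match-source-∈ _ W fixed (match⇒tgt hit)) r refl (sym (match⇒tgt hit))

  record Move : Set where
    field
      perm          : Permutation n n
      support       : List (Fin n)
      fixes-outside : ∀ z → All (z ≢_) support → perm ⟨$⟩ʳ z ≡ z
      x-outside     : All (x ≢_) support
      y-outside     : All (y ≢_) support

  open Move

  record SingleMove (τ : Permutation n n) : Set where
    field
      move   : Move
      edge   : Fin m
      single : UniqueMatch is js (perm move ∘ₚ τ) edge

  record IdleMove (τ : Permutation n n) : Set where
    field
      move : Move
      idle : NoMatch is js (perm move ∘ₚ τ)

  open SingleMove
  open IdleMove

  Separated : List (Fin n) → List (Fin n) → Set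
  Separated V W = All (λ v → All (v ≢_) W) V

  move#X : (μ : Move) → Disjoint (perm μ) X
  move#X μ z = by-cases (z ≟ x) (z ≟ y)
    where
      by-cases : Dec (z ≡ x) → Dec (z ≡ y) → perm μ ⟨$⟩ʳ z ≡ z ⊎ X ⟨$⟩ʳ z ≡ z
      by-cases (yes refl) _          = inj₁ (fixes-outside μ z (x-outside μ))
      by-cases (no _)     (yes refl) = inj₁ (fixes-outside μ z (y-outside μ))
      by-cases (no z≢x)   (no z≢y)   = inj₂ (transpose-fixes z≢x z≢y)

  separated⇒disjoint : (μ ν : Move) → Separated (support μ) (support ν) → Disjoint (perm μ) (perm ν)
  separated⇒disjoint μ ν sep z with Any.any? (z ≟_) (support μ)
  ... | yes z∈μ = inj₂ (fixes-outside ν z (All.lookup sep z∈μ))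
  ... | no z∉μ  = inj₁ (fixes-outside μ z (¬Any⇒All¬ _ z∉μ))

  spanned-by-single-moves : (τ τ′ : Permutation n n) → τ′ ≈ X ∘ₚ τ →
                            NoMatch is js τ → NoMatch is js (X ∘ₚ τ) →
                            (G H : SingleMove τ) → Separated (support (move G)) (support (move H)) →
                            Spanned is js (P2-diff τ τ′)
  spanned-by-single-moves τ τ′ τ′≈Xτ τ-none Xτ-none G H sep =
    C.spanned-if-g-h-single τ′ τ′≈Xτ (single G) (single H)
    where
      g h : Permutation n n
      g = perm (move G)
      h = perm (move H)
      module C = Cube.Matches τ X g h (move#X (move G)) (separated⇒disjoint (move G) (move H) sep)
                                (disjoint-sym h X (move#X (move H))) is js τ-none Xτ-none

  spanned-by-single-and-idle-moves :
    (σ′ : Permutation n n) → σ′ ≈ X ∘ₚ σ →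
    (G : SingleMove σ) (Z : IdleMove σ) → Separated (support (move G)) (support (move Z)) →
    (G₂ H₂ : SingleMove (perm (move Z) ∘ₚ σ)) → Separated (support (move G₂)) (support (move H₂)) →
    Spanned is js (P2-diff σ σ′)
  spanned-by-single-and-idle-moves σ′ σ′≈Xσ G Z sep G₂ H₂ sep₂ =
    C.spanned-if-g-single-h-idle σ′ σ′≈Xσ (single G) (idle Z)
      (spanned-by-single-moves (h ∘ₚ σ) (X ∘ₚ h ∘ₚ σ) (λ _ → refl)
                               (idle Z) (C.idle-h⇒noMatch-X∘h (idle Z)) G₂ H₂ sep₂)
    where
      g h : Permutation n n
      g = perm (move G)
      h = perm (move Z)
      module C = Cube.Matches σ X g h (move#X (move G)) (separated⇒disjoint (move G) (move Z) sep)
                                (disjoint-sym h X (move#X (move Z))) is js σ-none Xσ-none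

  AvoidsXY : Fin m → Set
  AvoidsXY r = All (x ≢_) (is r ∷ tgt r ∷ []) × All (y ≢_) (is r ∷ tgt r ∷ [])

  ReverseOf : Fin m → Set
  ReverseOf p = Σ[ p′ ∈ Fin m ] is p′ ≡ tgt p × tgt p′ ≡ is p

  NoReverse : Fin m → Set
  NoReverse p = ∀ r → is r ≡ tgt p → tgt r ≢ is p

  transpositionMove : ∀ p → NoReverse p → AvoidsXY p → SingleMove σ
  transpositionMove p no-rev (x-out , y-out) = record
    { move   = record { perm = transposition a b ; support = a ∷ b ∷ [] ; fixes-outside = fixed
                      ; x-outside = x-out ; y-outside = y-out }
    ; edge   = p
    ; single = uniqueMatch-by-table id (transposition a b) (a ∷ b ∷ []) fixed p (transposeˡ a b)
                 (inj₁ refl ∷ inj₂ (λ r a′≡b b′≡a → no-rev r a′≡b (trans b′≡a (transposeʳ a b))) ∷ [])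
    }
    where
      a b : Fin n
      a = is p
      b = tgt p
      fixed : ∀ z → All (z ≢_) (a ∷ b ∷ []) → transpose a b z ≡ z
      fixed z (z≢a ∷ z≢b ∷ []) = transpose-fixes z≢a z≢b

  -- If p has a reverse edge p′, the transposition of its endpoints would match p′ as well.
  threeCycleMove : ∀ p p′ → is p′ ≡ tgt p → tgt p′ ≡ is p → ∀ s → s ≢ is p → s ≢ tgt p →
                   All (x ≢_) (is p ∷ tgt p ∷ s ∷ []) → All (y ≢_) (is p ∷ tgt p ∷ s ∷ []) → SingleMove σ
  threeCycleMove p p′ a′≡b b′≡a s s≢a s≢b x-out y-out = record
    { move   = record { perm = transposition a b ∘ₚ transposition a s ; support = W ; fixes-outside = fixed
                      ; x-outside = x-out ; y-outside = y-out }
    ; edge   = p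
    ; single = uniqueMatch-by-table id (transposition a b ∘ₚ transposition a s) W fixed p ψa
                 (inj₁ refl ∷ inj₂ clear-b ∷ inj₂ clear-s ∷ [])
    }
    where
      a b : Fin n
      a = is p
      b = tgt p
      W : List (Fin n)
      W = a ∷ b ∷ s ∷ []
      ψ : Fin n → Fin n
      ψ z = transpose a s (transpose a b z)
      b≢a : b ≢ a
      b≢a = is≢tgt p ∘ sym
      ψa : ψ a ≡ b
      ψa = rotate-a b≢a s≢a s≢b
      ψb : ψ b ≡ s
      ψb = rotate-b b≢a s≢a s≢b
      ψs : ψ s ≡ a
      ψs = rotate-c b≢a s≢a s≢b
      fixed : ∀ z → All (z ≢_) W → ψ z ≡ z
      fixed z (z≢a ∷ z≢b ∷ z≢s ∷ []) = rotate-fixes z≢a z≢b z≢s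
      clear-b : Clear ψ b
      clear-b r aᵣ≡b bᵣ≡ψb =
        s≢a (trans (sym (trans bᵣ≡ψb ψb)) (trans (cong tgt (is-inj (trans aᵣ≡b (sym a′≡b)))) b′≡a))
      clear-s : Clear ψ s
      clear-s r aᵣ≡s bᵣ≡ψs =
        s≢b (trans (sym aᵣ≡s) (trans (cong is (tgt-injective (trans (trans bᵣ≡ψs ψs) (sym b′≡a)))) a′≡b))

  idleMove : ∀ e₁ e₂ → is e₁ ≡ tgt e₂ → ∀ s → s ≢ tgt e₁ → s ≢ is e₂ →
             All (x ≢_) (is e₁ ∷ s ∷ []) → All (y ≢_) (is e₁ ∷ s ∷ []) → IdleMove σ
  idleMove e₁ e₂ u≡b₂ s s≢b₁ s≢a₂ x-out y-out = record
    { move = record { perm = transposition u s ; support = u ∷ s ∷ [] ; fixes-outside = fixed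
                    ; x-outside = x-out ; y-outside = y-out }
    ; idle = noMatch-by-table (transposition u s) (u ∷ s ∷ []) fixed (clear-u ∷ clear-s ∷ [])
    }
    where
      u : Fin n
      u = is e₁
      fixed : ∀ z → All (z ≢_) (u ∷ s ∷ []) → transpose u s z ≡ z
      fixed z (z≢u ∷ z≢s ∷ []) = transpose-fixes z≢u z≢s
      clear-u : Clear (transpose u s) u
      clear-u r aᵣ≡u bᵣ≡ψu = s≢b₁ (trans (sym (trans bᵣ≡ψu (transposeˡ u s))) (cong tgt (is-inj aᵣ≡u)))
      clear-s : Clear (transpose u s) s
      clear-s r aᵣ≡s bᵣ≡ψs =
        s≢a₂ (trans (sym aᵣ≡s) (cong is (tgt-injective (trans (trans bᵣ≡ψs (transposeʳ u s)) u≡b₂))))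

  shiftedSourceMove : ∀ e₁ e₂ e₃ → is e₁ ≡ tgt e₂ → tgt e₃ ≡ is e₂ → ∀ s →
                      is e₃ ≢ s → tgt e₁ ≢ s → s ≢ is e₂ → s ≢ is e₁ →
                      All (x ≢_) (is e₂ ∷ s ∷ []) → All (y ≢_) (is e₂ ∷ s ∷ []) →
                      SingleMove (transposition (is e₁) s ∘ₚ σ)
  shiftedSourceMove e₁ e₂ e₃ u≡b₂ b₃≡v s a₃≢s b₁≢s s≢v s≢u x-out y-out = record
    { move   = record { perm = transposition v s ; support = v ∷ s ∷ [] ; fixes-outside = fixed
                      ; x-outside = x-out ; y-outside = y-out }
    ; edge   = e₂
    ; single = uniqueMatch-by-table (transposition u s) (transposition v s) W fixed′ e₂ (trans ψv u≡b₂)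
                 (inj₁ refl ∷ inj₂ clear-s ∷ inj₂ clear-u ∷ [])
    }
    where
      u v : Fin n
      u = is e₁
      v = is e₂
      W : List (Fin n)
      W = v ∷ s ∷ u ∷ []
      v≢u : v ≢ u
      v≢u v≡u = is≢tgt e₂ (trans v≡u u≡b₂)
      ψ : Fin n → Fin n
      ψ z = transpose u s (transpose v s z)
      ψv : ψ v ≡ u
      ψv = trans (cong (transpose u s) (transposeˡ v s)) (transposeʳ u s)
      ψs : ψ s ≡ v
      ψs = trans (cong (transpose u s) (transposeʳ v s)) (transpose-fixes v≢u (s≢v ∘ sym))
      ψu : ψ u ≡ s
      ψu = trans (cong (transpose u s) (transpose-fixes (v≢u ∘ sym) (s≢u ∘ sym))) (transposeˡ u s)
      fixed : ∀ z → All (z ≢_) (v ∷ s ∷ []) → transpose v s z ≡ z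
      fixed z (z≢v ∷ z≢s ∷ []) = transpose-fixes z≢v z≢s
      fixed′ : ∀ z → All (z ≢_) W → ψ z ≡ z
      fixed′ z (z≢v ∷ z≢s ∷ z≢u ∷ []) =
        trans (cong (transpose u s) (transpose-fixes z≢v z≢s)) (transpose-fixes z≢u z≢s)
      clear-s : Clear ψ s
      clear-s r aᵣ≡s bᵣ≡ψs =
        a₃≢s (trans (cong is (sym (tgt-injective (trans (trans bᵣ≡ψs ψs) (sym b₃≡v))))) aᵣ≡s)
      clear-u : Clear ψ u
      clear-u r aᵣ≡u bᵣ≡ψu = b₁≢s (trans (cong tgt (sym (is-inj aᵣ≡u))) (trans bᵣ≡ψu ψu))

  shiftedTargetMove : ∀ e₁ e₂ e₄ → is e₁ ≡ tgt e₂ → is e₄ ≡ tgt e₁ → ∀ s →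
                      tgt e₄ ≢ s → is e₂ ≢ s → tgt e₁ ≢ s → s ≢ is e₁ →
                      All (x ≢_) (is e₁ ∷ tgt e₁ ∷ []) → All (y ≢_) (is e₁ ∷ tgt e₁ ∷ []) →
                      SingleMove (transposition (is e₁) s ∘ₚ σ)
  shiftedTargetMove e₁ e₂ e₄ u≡b₂ a₄≡w s b₄≢s a₂≢s w≢s s≢u x-out y-out = record
    { move   = record { perm = transposition u w ; support = u ∷ w ∷ [] ; fixes-outside = fixed
                      ; x-outside = x-out ; y-outside = y-out }
    ; edge   = e₁
    ; single = uniqueMatch-by-table (transposition u s) (transposition u w) W fixed′ e₁ ψu
                 (inj₁ refl ∷ inj₂ clear-w ∷ inj₂ clear-s ∷ [])
    }
    where
      u w : Fin n
      u = is e₁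
      w = tgt e₁
      W : List (Fin n)
      W = u ∷ w ∷ s ∷ []
      ψ : Fin n → Fin n
      ψ z = transpose u s (transpose u w z)
      w≢u : w ≢ u
      w≢u = is≢tgt e₁ ∘ sym
      s≢w : s ≢ w
      s≢w = w≢s ∘ sym
      ψu : ψ u ≡ w
      ψu = rotate-a w≢u s≢u s≢w
      ψw : ψ w ≡ s
      ψw = rotate-b w≢u s≢u s≢w
      ψs : ψ s ≡ u
      ψs = rotate-c w≢u s≢u s≢w
      fixed : ∀ z → All (z ≢_) (u ∷ w ∷ []) → transpose u w z ≡ z
      fixed z (z≢u ∷ z≢w ∷ []) = transpose-fixes z≢u z≢w
      fixed′ : ∀ z → All (z ≢_) W → ψ z ≡ z
      fixed′ z (z≢u ∷ z≢w ∷ z≢s ∷ []) = rotate-fixes z≢u z≢w z≢s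
      clear-w : Clear ψ w
      clear-w r aᵣ≡w bᵣ≡ψw =
        b₄≢s (trans (cong tgt (sym (is-inj (trans aᵣ≡w (sym a₄≡w))))) (trans bᵣ≡ψw ψw))
      clear-s : Clear ψ s
      clear-s r aᵣ≡s bᵣ≡ψs =
        a₂≢s (trans (cong is (sym (tgt-injective (trans (trans bᵣ≡ψs ψs) u≡b₂)))) aᵣ≡s)

  shiftedThreeCycleMove : ∀ p p′ q q′ → is p′ ≡ tgt p → tgt p′ ≡ is p → is q′ ≡ tgt q → tgt q′ ≡ is q → ∀ s →
                          tgt p ≢ is q′ → is p ≢ is q′ → is q ≢ is p →
                          s ≢ is p → s ≢ tgt p → s ≢ is q → s ≢ is q′ →
                          All (x ≢_) (is p ∷ tgt p ∷ is q′ ∷ []) → All (y ≢_) (is p ∷ tgt p ∷ is q′ ∷ []) →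
                          SingleMove (transposition (is q′) s ∘ₚ σ)
  shiftedThreeCycleMove p p′ q q′ a′≡b b′≡a c′≡d d′≡c s b≢d a≢d c≢a s≢a s≢b s≢c s≢d x-out y-out = record
    { move   = record { perm = transposition a b ∘ₚ transposition a d ; support = a ∷ b ∷ d ∷ []
                      ; fixes-outside = fixed ; x-outside = x-out ; y-outside = y-out }
    ; edge   = p
    ; single = uniqueMatch-by-table (transposition d s) (transposition a b ∘ₚ transposition a d) W fixed′ p ψa
                 (inj₁ refl ∷ inj₂ clear-b ∷ inj₂ clear-d ∷ inj₂ clear-s ∷ [])
    }
    where
      a b d : Fin n
      a = is p
      b = tgt p
      d = is q′
      W : List (Fin n)
      W = a ∷ b ∷ d ∷ s ∷ []
      b≢a : b ≢ a
      b≢a = is≢tgt p ∘ sym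
      d≢a : d ≢ a
      d≢a = a≢d ∘ sym
      d≢b : d ≢ b
      d≢b = b≢d ∘ sym
      ψ : Fin n → Fin n
      ψ z = transpose d s (transpose a d (transpose a b z))
      ψa : ψ a ≡ b
      ψa = trans (cong (transpose d s) (rotate-a b≢a d≢a d≢b)) (transpose-fixes b≢d (s≢b ∘ sym))
      ψb : ψ b ≡ s
      ψb = trans (cong (transpose d s) (rotate-b b≢a d≢a d≢b)) (transposeˡ d s)
      ψd : ψ d ≡ a
      ψd = trans (cong (transpose d s) (rotate-c b≢a d≢a d≢b)) (transpose-fixes a≢d (s≢a ∘ sym))
      ψs : ψ s ≡ d
      ψs = trans (cong (transpose d s) (rotate-fixes s≢a s≢b s≢d)) (transposeʳ d s)
      fixed : ∀ z → All (z ≢_) (a ∷ b ∷ d ∷ []) → transpose a d (transpose a b z) ≡ z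
      fixed z (z≢a ∷ z≢b ∷ z≢d ∷ []) = rotate-fixes z≢a z≢b z≢d
      fixed′ : ∀ z → All (z ≢_) W → ψ z ≡ z
      fixed′ z (z≢a ∷ z≢b ∷ z≢d ∷ z≢s ∷ []) =
        trans (cong (transpose d s) (rotate-fixes z≢a z≢b z≢d)) (transpose-fixes z≢d z≢s)
      clear-b : Clear ψ b
      clear-b r aᵣ≡b bᵣ≡ψb =
        s≢a (trans (sym (trans bᵣ≡ψb ψb)) (trans (cong tgt (is-inj (trans aᵣ≡b (sym a′≡b)))) b′≡a))
      clear-d : Clear ψ d
      clear-d r aᵣ≡d bᵣ≡ψd = c≢a (trans (sym d′≡c) (trans (cong tgt (sym (is-inj aᵣ≡d))) (trans bᵣ≡ψd ψd)))
      clear-s : Clear ψ s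
      clear-s r aᵣ≡s bᵣ≡ψs = s≢c (trans (sym aᵣ≡s) (cong is (tgt-injective (trans (trans bᵣ≡ψs ψs) c′≡d))))

  reverse? : ∀ p → ReverseOf p ⊎ NoReverse p
  reverse? p with any? (λ r → (is r ≟ tgt p) ×-dec (tgt r ≟ is p))
  ... | yes found = inj₁ found
  ... | no none   = inj₂ (λ r a≡b b≡a → none (r , a≡b , b≡a))

  marked : Fin 4 → Fin n
  marked 0F = x
  marked 1F = x
  marked 2F = y
  marked 3F = y

  endpoint : Fin 4 → Fin m → Fin n
  endpoint 0F = is
  endpoint 1F = tgt
  endpoint 2F = is
  endpoint 3F = tgt

  endpoint-injective : ∀ k → Injective _≡_ _≡_ (endpoint k)
  endpoint-injective 0F = is-inj
  endpoint-injective 1F = tgt-injective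
  endpoint-injective 2F = is-inj
  endpoint-injective 3F = tgt-injective

  Touches : Fin m → Set
  Touches r = Σ[ k ∈ Fin 4 ] marked k ≡ endpoint k r

  touches-injective : ∀ {r r′} (t : Touches r) (t′ : Touches r′) → proj₁ t ≡ proj₁ t′ → r ≡ r′
  touches-injective (k , x≡) (.k , x≡′) refl = endpoint-injective k (trans (sym x≡) x≡′)

  avoids? : ∀ r → Dec (AvoidsXY r)
  avoids? r = all? (¬? ∘ (x ≟_)) (is r ∷ tgt r ∷ []) ×-dec all? (¬? ∘ (y ≟_)) (is r ∷ tgt r ∷ [])

  ¬avoids⇒touches : ∀ r → ¬ AvoidsXY r → Touches r
  ¬avoids⇒touches r ¬avoids with any? (λ k → marked k ≟ endpoint k r)
  ... | yes found = found
  ... | no none   = ⊥-elim (¬avoids ((miss 0F ∷ miss 1F ∷ []) , (miss 2F ∷ miss 3F ∷ [])))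
    where
      miss : ∀ k → marked k ≢ endpoint k r
      miss k x≡ = none (k , x≡)

  -- x and y each touch at most two edges: injectivity of is and tgt.
  avoider-among-five : (φ : Fin 5 → Fin m) → Injective _≡_ _≡_ φ → Σ[ k ∈ Fin 5 ] AvoidsXY (φ k)
  avoider-among-five φ φ-inj with any? (avoids? ∘ φ)
  ... | yes found = found
  ... | no none   = ⊥-elim (collision (pigeonhole (n<1+n 4) (proj₁ ∘ touching)))
    where
      touching : ∀ k → Touches (φ k)
      touching k = ¬avoids⇒touches (φ k) (λ avoids → none (k , avoids))
      collision : ¬ ∃₂ (λ i j → i <ᶠ j × proj₁ (touching i) ≡ proj₁ (touching j))
      collision (i , j , i<j , same) = <⇒≢ i<j (φ-inj (touches-injective (touching i) (touching j) same))

  avoider : ∀ {k} (φ : Fin k → Fin m) → Injective _≡_ _≡_ φ → 5 ≤ k → Σ[ i ∈ Fin k ] AvoidsXY (φ i)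
  avoider φ φ-inj 5≤k with avoider-among-five (φ ∘ (λ i → inject≤ i 5≤k)) (inject≤-injective 5≤k 5≤k _ _ ∘ φ-inj)
  ... | i , avoids = inject≤ i 5≤k , avoids

  data Configuration : Set where
    separate : ∀ p q → AvoidsXY p → AvoidsXY q → p ≢ q → is p ≢ tgt q → tgt p ≢ is q → Configuration
    triangle : ∀ p q u → AvoidsXY p → AvoidsXY q → AvoidsXY u →
               tgt p ≡ is q → tgt q ≡ is u → tgt u ≡ is p → Configuration

  adjacency? : ∀ p q → tgt p ≡ is q ⊎ tgt q ≡ is p ⊎ (is p ≢ tgt q × tgt p ≢ is q)
  adjacency? p q with tgt p ≟ is q | tgt q ≟ is p
  ... | yes b≡c | _       = inj₁ b≡c
  ... | no _    | yes d≡a = inj₂ (inj₁ d≡a)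
  ... | no b≢c  | no d≢a  = inj₂ (inj₂ ((d≢a ∘ sym) , b≢c))

  configuration-from-arc : ∀ r₁ r₂ r₃ → AvoidsXY r₁ → AvoidsXY r₂ → AvoidsXY r₃ →
                           r₁ ≢ r₃ → r₂ ≢ r₃ → tgt r₁ ≡ is r₂ → Configuration
  configuration-from-arc r₁ r₂ r₃ av₁ av₂ av₃ r₁≢r₃ r₂≢r₃ b₁≡a₂ with adjacency? r₂ r₃
  ... | inj₂ (inj₂ (a₂≢b₃ , b₂≢a₃)) = separate r₂ r₃ av₂ av₃ r₂≢r₃ a₂≢b₃ b₂≢a₃
  ... | inj₂ (inj₁ b₃≡a₂) = ⊥-elim (r₁≢r₃ (tgt-injective (trans b₁≡a₂ (sym b₃≡a₂))))
  ... | inj₁ b₂≡a₃ with is r₁ ≟ tgt r₃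
  ...   | yes a₁≡b₃ = triangle r₁ r₂ r₃ av₁ av₂ av₃ b₁≡a₂ b₂≡a₃ (sym a₁≡b₃)
  ...   | no a₁≢b₃  = separate r₁ r₃ av₁ av₃ r₁≢r₃ a₁≢b₃ (λ b₁≡a₃ → r₂≢r₃ (is-inj (trans (sym b₁≡a₂) b₁≡a₃)))

  configuration : ∀ r₁ r₂ r₃ → AvoidsXY r₁ → AvoidsXY r₂ → AvoidsXY r₃ →
                  r₁ ≢ r₂ → r₁ ≢ r₃ → r₂ ≢ r₃ → Configuration
  configuration r₁ r₂ r₃ av₁ av₂ av₃ r₁≢r₂ r₁≢r₃ r₂≢r₃ with adjacency? r₁ r₂
  ... | inj₁ b₁≡a₂                  = configuration-from-arc r₁ r₂ r₃ av₁ av₂ av₃ r₁≢r₃ r₂≢r₃ b₁≡a₂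
  ... | inj₂ (inj₁ b₂≡a₁)           = configuration-from-arc r₂ r₁ r₃ av₂ av₁ av₃ r₂≢r₃ r₁≢r₃ b₂≡a₁
  ... | inj₂ (inj₂ (a₁≢b₂ , b₁≢a₂)) = separate r₁ r₂ av₁ av₂ r₁≢r₂ a₁≢b₂ b₁≢a₂

  avoiding-configuration : 7 ≤ m → Configuration
  avoiding-configuration 7≤m =
    configuration r₁ r₂ r₃ (proj₂ pick₁) (proj₂ pick₂) (proj₂ pick₃) (r₂≢r₁ ∘ sym) (r₃≢r₁ ∘ sym) (r₃≢r₂ ∘ sym)
    where
      φ₇ : Fin 7 → Fin m
      φ₇ i = inject≤ i 7≤m
      φ₇-inj : Injective _≡_ _≡_ φ₇
      φ₇-inj = inject≤-injective 7≤m 7≤m _ _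
      pick₁ : Σ[ i ∈ Fin 7 ] AvoidsXY (φ₇ i)
      pick₁ = avoider φ₇ φ₇-inj (≤-trans (n≤1+n 5) (n≤1+n 6))
      i₁ : Fin 7
      i₁ = proj₁ pick₁
      pick₂ : Σ[ i ∈ Fin 6 ] AvoidsXY (φ₇ (punchIn i₁ i))
      pick₂ = avoider (φ₇ ∘ punchIn i₁) (∘punchIn-injective φ₇-inj i₁) (n≤1+n 5)
      i₂ : Fin 6
      i₂ = proj₁ pick₂
      pick₃ : Σ[ i ∈ Fin 5 ] AvoidsXY (φ₇ (punchIn i₁ (punchIn i₂ i)))
      pick₃ = avoider (φ₇ ∘ punchIn i₁ ∘ punchIn i₂) (∘punchIn-injective (∘punchIn-injective φ₇-inj i₁) i₂) ≤-refl
      i₃ : Fin 5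
      i₃ = proj₁ pick₃
      r₁ r₂ r₃ : Fin m
      r₁ = φ₇ i₁
      r₂ = φ₇ (punchIn i₁ i₂)
      r₃ = φ₇ (punchIn i₁ (punchIn i₂ i₃))
      r₂≢r₁ : r₂ ≢ r₁
      r₂≢r₁ = ∘punchIn-misses φ₇-inj i₁ i₂
      r₃≢r₁ : r₃ ≢ r₁
      r₃≢r₁ = ∘punchIn-misses φ₇-inj i₁ (punchIn i₂ i₃)
      r₃≢r₂ : r₃ ≢ r₂
      r₃≢r₂ = ∘punchIn-misses (∘punchIn-injective φ₇-inj i₁) i₂ i₃

  module _ (σ′ : Permutation n n) (σ′≈Xσ : σ′ ≈ X ∘ₚ σ) where

    spanned-from-separate-edges :
      ∀ p q → AvoidsXY p → AvoidsXY q → p ≢ q → is p ≢ tgt q → tgt p ≢ is q →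
      ∀ s → All (s ≢_) (x ∷ y ∷ is p ∷ tgt p ∷ is q ∷ tgt q ∷ []) → Spanned is js (P2-diff σ σ′)
    spanned-from-separate-edges p q avoid-p@((x≢a ∷ x≢b ∷ []) , (y≢a ∷ y≢b ∷ []))
                                    avoid-q@((x≢c ∷ x≢d ∷ []) , (y≢c ∷ y≢d ∷ [])) p≢q a≢d b≢c
                                s (s≢x ∷ s≢y ∷ s≢a ∷ s≢b ∷ s≢c ∷ s≢d ∷ []) =
      by-reverses (reverse? p) (reverse? q)
      where
        a≢c : is p ≢ is q
        a≢c = p≢q ∘ is-inj
        b≢d : tgt p ≢ tgt q
        b≢d = p≢q ∘ tgt-injective
        by-reverses : ReverseOf p ⊎ NoReverse p → ReverseOf q ⊎ NoReverse q → Spanned is js (P2-diff σ σ′)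
        by-reverses (inj₂ no-rev-p) (inj₂ no-rev-q) =
          spanned-by-single-moves σ σ′ σ′≈Xσ σ-none Xσ-none
            (transpositionMove p no-rev-p avoid-p) (transpositionMove q no-rev-q avoid-q)
            ((a≢c ∷ a≢d ∷ []) ∷ (b≢c ∷ b≢d ∷ []) ∷ [])
        by-reverses (inj₁ (p′ , a′≡b , b′≡a)) (inj₂ no-rev-q) =
          spanned-by-single-moves σ σ′ σ′≈Xσ σ-none Xσ-none
            (threeCycleMove p p′ a′≡b b′≡a s s≢a s≢b
               (x≢a ∷ x≢b ∷ (s≢x ∘ sym) ∷ []) (y≢a ∷ y≢b ∷ (s≢y ∘ sym) ∷ []))
            (transpositionMove q no-rev-q avoid-q)
            ((a≢c ∷ a≢d ∷ []) ∷ (b≢c ∷ b≢d ∷ []) ∷ (s≢c ∷ s≢d ∷ []) ∷ [])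
        by-reverses (inj₂ no-rev-p) (inj₁ (q′ , c′≡d , d′≡c)) =
          spanned-by-single-moves σ σ′ σ′≈Xσ σ-none Xσ-none
            (transpositionMove p no-rev-p avoid-p)
            (threeCycleMove q q′ c′≡d d′≡c s s≢c s≢d
               (x≢c ∷ x≢d ∷ (s≢x ∘ sym) ∷ []) (y≢c ∷ y≢d ∷ (s≢y ∘ sym) ∷ []))
            ((a≢c ∷ a≢d ∷ (s≢a ∘ sym) ∷ []) ∷ (b≢c ∷ b≢d ∷ (s≢b ∘ sym) ∷ []) ∷ [])
        -- Two 3-cycles would need two fresh points, and n ≥ 7 only guarantees one.
        by-reverses (inj₁ (p′ , a′≡b , b′≡a)) (inj₁ (q′ , c′≡d , d′≡c)) =
          spanned-by-single-and-idle-moves σ′ σ′≈Xσ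
            (threeCycleMove p p′ a′≡b b′≡a (is q) (a≢c ∘ sym) (b≢c ∘ sym)
               (x≢a ∷ x≢b ∷ x≢c ∷ []) (y≢a ∷ y≢b ∷ y≢c ∷ []))
            (idleMove q′ q c′≡d s s≢d′ s≢c (x≢c′ ∷ (s≢x ∘ sym) ∷ []) (y≢c′ ∷ (s≢y ∘ sym) ∷ []))
            ((a≢c′ ∷ (s≢a ∘ sym) ∷ []) ∷ (b≢c′ ∷ (s≢b ∘ sym) ∷ []) ∷ (c≢c′ ∷ (s≢c ∘ sym) ∷ []) ∷ [])
            (shiftedThreeCycleMove p p′ q q′ a′≡b b′≡a c′≡d d′≡c s b≢c′ a≢c′ (a≢c ∘ sym) s≢a s≢b s≢c s≢c′
               (x≢a ∷ x≢b ∷ x≢c′ ∷ []) (y≢a ∷ y≢b ∷ y≢c′ ∷ []))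
            (shiftedSourceMove q′ q q′ c′≡d d′≡c s (s≢c′ ∘ sym) (s≢d′ ∘ sym) s≢c s≢c′
               (x≢c ∷ (s≢x ∘ sym) ∷ []) (y≢c ∷ (s≢y ∘ sym) ∷ []))
            ((a≢c ∷ (s≢a ∘ sym) ∷ []) ∷ (b≢c ∷ (s≢b ∘ sym) ∷ []) ∷ ((c≢c′ ∘ sym) ∷ (s≢c′ ∘ sym) ∷ []) ∷ [])
          where
            via-d : ∀ {z} → z ≢ tgt q → z ≢ is q′
            via-d z≢d z≡c′ = z≢d (trans z≡c′ c′≡d)
            a≢c′ : is p ≢ is q′
            a≢c′ = via-d a≢d
            b≢c′ : tgt p ≢ is q′
            b≢c′ = via-d b≢d
            c≢c′ : is q ≢ is q′
            c≢c′ = via-d (is≢tgt q)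
            s≢c′ : s ≢ is q′
            s≢c′ = via-d s≢d
            x≢c′ : x ≢ is q′
            x≢c′ = via-d x≢d
            y≢c′ : y ≢ is q′
            y≢c′ = via-d y≢d
            s≢d′ : s ≢ tgt q′
            s≢d′ s≡d′ = s≢c (trans s≡d′ d′≡c)

    spanned-from-triangle :
      ∀ p q u → AvoidsXY p → AvoidsXY q → AvoidsXY u → tgt p ≡ is q → tgt q ≡ is u → tgt u ≡ is p →
      ∀ s → All (s ≢_) (x ∷ y ∷ is p ∷ is q ∷ is u ∷ []) → Spanned is js (P2-diff σ σ′)
    spanned-from-triangle p q u avoid-p ((x≢b ∷ _) , (y≢b ∷ _)) ((x≢c ∷ x≢tgt-u ∷ []) , (y≢c ∷ y≢tgt-u ∷ []))
                          p→q q→u u→p s (s≢x ∷ s≢y ∷ s≢a ∷ s≢b ∷ s≢c ∷ []) =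
      spanned-by-single-and-idle-moves σ′ σ′≈Xσ
        (transpositionMove p no-rev avoid-p)
        (idleMove u q (sym q→u) s (tgt-u≢s ∘ sym) s≢b (x≢c ∷ (s≢x ∘ sym) ∷ []) (y≢c ∷ (s≢y ∘ sym) ∷ []))
        (((c≢a ∘ sym) ∷ (s≢a ∘ sym) ∷ []) ∷ (tgt-p≢c ∷ tgt-p≢s ∷ []) ∷ [])
        (shiftedTargetMove u q p (sym q→u) (sym u→p) s tgt-p≢s (s≢b ∘ sym) tgt-u≢s s≢c
           (x≢c ∷ x≢tgt-u ∷ []) (y≢c ∷ y≢tgt-u ∷ []))
        (shiftedSourceMove u q p (sym q→u) p→q s (s≢a ∘ sym) tgt-u≢s s≢b s≢c
           (x≢b ∷ (s≢x ∘ sym) ∷ []) (y≢b ∷ (s≢y ∘ sym) ∷ []))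
        (((b≢c ∘ sym) ∷ (s≢c ∘ sym) ∷ []) ∷ (tgt-u≢b ∷ tgt-u≢s ∷ []) ∷ [])
      where
        a≢b : is p ≢ is q
        a≢b a≡b = is≢tgt p (trans a≡b (sym p→q))
        b≢c : is q ≢ is u
        b≢c b≡c = is≢tgt q (trans b≡c (sym q→u))
        c≢a : is u ≢ is p
        c≢a c≡a = is≢tgt u (trans c≡a (sym u→p))
        tgt-p≢c : tgt p ≢ is u
        tgt-p≢c = b≢c ∘ trans (sym p→q)
        tgt-p≢s : tgt p ≢ s
        tgt-p≢s tgt-p≡s = s≢b (trans (sym tgt-p≡s) p→q)
        tgt-u≢s : tgt u ≢ s
        tgt-u≢s tgt-u≡s = s≢a (trans (sym tgt-u≡s) u→p)
        tgt-u≢b : tgt u ≢ is q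
        tgt-u≢b = a≢b ∘ trans (sym u→p)
        no-rev : NoReverse p
        no-rev r aᵣ≡b bᵣ≡a = c≢a (trans (sym q→u) (trans (cong tgt (sym (is-inj (trans aᵣ≡b p→q)))) bᵣ≡a))

    spanned-from-configuration : 7 ≤ n → Configuration → Spanned is js (P2-diff σ σ′)
    spanned-from-configuration 7≤n (separate p q av-p av-q p≢q a≢d b≢c) =
      let s , s-fresh = fresh (x ∷ y ∷ is p ∷ tgt p ∷ is q ∷ tgt q ∷ []) 7≤n
      in spanned-from-separate-edges p q av-p av-q p≢q a≢d b≢c s s-fresh
    spanned-from-configuration 7≤n (triangle p q u av-p av-q av-u p→q q→u u→p) =
      let s , s-fresh = fresh (x ∷ y ∷ is p ∷ is q ∷ is u ∷ []) (≤-trans (n≤1+n 6) 7≤n)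
      in spanned-from-triangle p q u av-p av-q av-u p→q q→u u→p s s-fresh

lemma7 : (m n : ℕ) → m ≥ 7 → n ≥ 7 →
    (is js : Fin m → Fin n) → Injective _≡_ _≡_ is → Injective _≡_ _≡_ js →
    (σ σ' : Permutation n n) → InS is js 0 σ → InS is js 0 σ' →
    (x y : Fin n) → x ≢ y → (∀ z → σ' ⟨$⟩ʳ z ≡ σ ⟨$⟩ʳ transpose x y z) →
    InLinHull (InS12 is js) (λ a b → P2 σ a b - P2 σ' a b)
lemma7 m n m≥7 n≥7 is js is-inj js-inj σ σ′ σ∈S₀ σ′∈S₀ x y _ σ′≈Xσ =
  spanned-from-configuration σ′ σ′≈Xσ n≥7 (avoiding-configuration m≥7)
  where
    σ-none : NoMatch is js σ
    σ-none = matchCount≡0⇒noMatch is js σ σ∈S₀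
    Xσ-none : NoMatch is js (transposition x y ∘ₚ σ)
    Xσ-none r hit = matchCount≡0⇒noMatch is js σ′ σ′∈S₀ r (trans (σ′≈Xσ (is r)) hit)
    open Moves is js is-inj js-inj σ x y σ-none Xσ-none
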